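{- Let $G$ be a singular digraph of order $n\ge 2$ and let $v\in V(G)$. Then: (i) if $v$ is dextro-core and laevo-core, then $\eta(G-v)=\eta(G)-1$; (ii) if $v$ is dextro-core-forbidden and laevo-core, then $\eta(G-v)=\eta(G)$; (iii) if $v$ is dextro-core and laevo-core-forbidden, then $\eta(G-v)=\eta(G)$; (iv) if $v$ is dextro-core-forbidden and laevo-core-forbidden, then $\eta(G-v)\in\{\eta(G),\eta(G)+1\}$; moreover, if $G$ is bipartite then $\eta(G-v)=\eta(G)+1$.
   Context: A digraph $G$ is a finite nonempty vertex set $V(G)$ with an arbitrary binary relation $\to$; its adjacency matrix $A(G)$ (w.r.t. an ordering $v_1,\dots,v_n$) has $A_{ij}=1$ iff $v_i\to v_j$ and $0$ otherwise. $\operatorname{Ker}G$ is the kernel of $A(G)$ and $\operatorname{CoKer}G$ the kernel of $A(G)^\intercal$; equivalently $\mathbf{x}\in\operatorname{Ker}G$ iff $\sum_{u: v\to u}\mathbf{x}(u)=0$ for all $v$ and $\mathbf{x}\in\operatorname{CoKer}G$ iff $\sum_{u:u\to v}\mathbf{x}(u)=0$ for all $v$. The nullity is $\eta(G)=\dim\operatorname{Ker}G$, and $G$ is singular if $\eta(G)>0$. $G-v$ denotes the digraph obtained by deleting $v$. A vertex $v$ is dextro-core if some $\mathbf{x}\in\operatorname{Ker}G$ has $\mathbf{x}(v)\neq 0$ (otherwise dextro-core-forbidden), and laevo-core if some $\mathbf{y}\in\operatorname{CoKer}G$ has $\mathbf{y}(v)\ne 0$ (otherwise laevo-core-forbidden).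 $G$ is bipartite if $V(G)$ can be partitioned into $V_1,V_2$ such that every arc has one end in $V_1$ and the other in $V_2$.
   Formalization: Kernel and cokernel vectors have rational coordinates instead of real ones, so the nullity η and the dextro-core, laevo-core and core-forbidden notions are taken over ℚ. -}

module Defs where

open import Data.Nat using (ℕ; zero; suc)
open import Data.Fin using (Fin; zero; suc; punchIn)
open import Data.Bool using (Bool; true; false; if_then_else_)
open import Data.Rational using (ℚ; 0ℚ; 1ℚ; _+_; _*_)
open import Data.Product using (Σ; ∃; _×_; _,_)
open import Relation.Binary.PropositionalEquality using (_≡_; _≢_)

-- A digraph on the vertex set Fin n: an arbitrary (decidable) binary relation,
-- G i j ≡ true  iff  v_i → v_j  (loops allowed).
Digraph : ℕ → Set
Digraph n = Fin n → Fin n → Bool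

adj : ∀ {n} → Digraph n → Fin n → Fin n → ℚ
adj G i j = if G i j then 1ℚ else 0ℚ

sumℚ : ∀ {n} → (Fin n → ℚ) → ℚ
sumℚ {zero}  f = 0ℚ
sumℚ {suc n} f = f zero + sumℚ (λ i → f (suc i))

Vector : ℕ → Set
Vector n = Fin n → ℚ

InKer : ∀ {n} → Digraph n → Vector n → Set
InKer G x = ∀ i → sumℚ (λ j → adj G i j * x j) ≡ 0ℚ

InCoKer : ∀ {n} → Digraph n → Vector n → Set
InCoKer G y = ∀ j → sumℚ (λ i → adj G i j * y i) ≡ 0ℚ

lincomb : ∀ {n k} → (Fin k → ℚ) → (Fin k → Vector n) → Vector n
lincomb c b i = sumℚ (λ t → c t * b t i)

IsKerBasis : ∀ {n k} → Digraph n → (Fin k → Vector n) → Set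
IsKerBasis G b =
  (∀ t → InKer G (b t)) ×
  (∀ c → (∀ i → lincomb c b i ≡ 0ℚ) → ∀ t → c t ≡ 0ℚ) ×
  (∀ x → InKer G x → Σ (Fin _ → ℚ) λ c → ∀ i → x i ≡ lincomb c b i)

Nullity : ∀ {n} → Digraph n → ℕ → Set
Nullity {n} G k = Σ (Fin k → Vector n) (IsKerBasis G)

delete : ∀ {m} → Digraph (suc m) → Fin (suc m) → Digraph m
delete G v i j = G (punchIn v i) (punchIn v j)

DextroCore : ∀ {n} → Digraph n → Fin n → Set
DextroCore G v = ∃ λ x → InKer G x × x v ≢ 0ℚ

LaevoCore : ∀ {n} → Digraph n → Fin n → Set
LaevoCore G v = ∃ λ y → InCoKer G y × y v ≢ 0ℚ

DextroCoreForbidden : ∀ {n} → Digraph n → Fin n → Set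
DextroCoreForbidden G v = ∀ x → InKer G x → x v ≡ 0ℚ

LaevoCoreForbidden : ∀ {n} → Digraph n → Fin n → Set
LaevoCoreForbidden G v = ∀ y → InCoKer G y → y v ≡ 0ℚ

Bipartite : ∀ {n} → Digraph n → Set
Bipartite G = ∃ λ (f : Fin _ → Bool) → ∀ i j → G i j ≡ true → f i ≢ f j

{-# OPTIONS --safe #-}

-- Let A be the adjacency matrix of G, r the row of v restricted to the other vertices, and
-- K₀ = {x ∈ Ker A : x(v) = 0}.  Dropping the v-coordinate identifies K₀ with {w ∈ Ker(G − v) : r·w = 0},
-- so η(G) = dim K₀ + [v is dextro-core] and η(G − v) = dim K₀ + [r does not vanish on Ker(G − v)].
-- If yᵀA = 0 and y(v) ≠ 0, then y(v)·(r·w) = yᵀA(w extended by 0) = 0, so r vanishes on Ker(G − v).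
-- If v is laevo-core-forbidden, the Fredholm alternative solves A z = e_v.  Subtracting from z a multiple of a
-- kernel vector x with x(v) ≠ 0, or (G bipartite) keeping z only on the colour class not containing v, gives
-- u with u(v) = 0 and A u = e_v; the restriction w of u then lies in Ker(G − v) and has r·w = 1.

module Submission where

open import Defs
open import Data.Nat using (ℕ; zero; suc; _≤_; _<_; z≤n; s≤s)
open import Data.Nat.Properties using (m≤n⇒m≤1+n; ≤-antisym)
open import Data.Fin using (Fin; zero; suc; punchIn; punchOut)
open import Data.Fin.Properties using (all?; ¬∀⟶∃¬; punchIn-punchOut)
open import Data.Vec.Functional using (insertAt; _∷_)
open import Data.Vec.Functional.Properties using (insertAt-lookup; insertAt-punchIn)
open import Data.Product using (Σ; _×_; _,_; proj₁; proj₂)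
open import Data.Sum using (_⊎_; inj₁; inj₂; map)
open import Data.Empty using (⊥-elim)
open import Function using (_∘_)
open import Relation.Binary.PropositionalEquality
open import Relation.Nullary using (yes; no; ¬_)

private
  variable
    n k l p q : ℕ

punchIn-cases : {P : Fin (suc n) → Set} (v : Fin (suc n)) → P v → (∀ i → P (punchIn v i)) → ∀ j → P j
punchIn-cases {P = P} v Pv P-punchIn j with v Data.Fin.≟ j
... | yes refl = Pv
... | no  v≢j  = subst P (punchIn-punchOut v≢j) (P-punchIn (punchOut v≢j))

module LinearAlgebra where

  open import Data.Rational using (ℚ; 0ℚ; 1ℚ; _+_; _*_; -_; _-_; _÷_; 1/_; NonZero; ≢-nonZero)
  open import Data.Rational.Properties
    using (_≟_; *-zeroˡ; *-zeroʳ; *-comm; *-assoc; *-identityʳ; *-inverseʳ; +-inverseʳ)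
  open import Data.Rational.Solver using (module +-*-Solver)
  open +-*-Solver
  open ≡-Reasoning

  sum-cong : {f g : Fin n → ℚ} → (∀ i → f i ≡ g i) → sumℚ f ≡ sumℚ g
  sum-cong {zero}  f≗g = refl
  sum-cong {suc n} f≗g = cong₂ _+_ (f≗g zero) (sum-cong (f≗g ∘ suc))

  sum-zero : {f : Fin n → ℚ} → (∀ i → f i ≡ 0ℚ) → sumℚ f ≡ 0ℚ
  sum-zero {zero}  f≗0 = refl
  sum-zero {suc n} f≗0 = cong₂ _+_ (f≗0 zero) (sum-zero (f≗0 ∘ suc))

  sum-+ : (f g : Fin n → ℚ) → sumℚ (λ i → f i + g i) ≡ sumℚ f + sumℚ g
  sum-+ {zero}  f g = refl
  sum-+ {suc n} f g = trans (cong (f zero + g zero +_) (sum-+ (f ∘ suc) (g ∘ suc)))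
    (solve 4 (λ a b c d → (a :+ b) :+ (c :+ d) := (a :+ c) :+ (b :+ d)) refl (f zero) (g zero) _ _)

  sum-linear : (f g : Fin n → ℚ) (a : ℚ) → sumℚ (λ i → f i - a * g i) ≡ sumℚ f - a * sumℚ g
  sum-linear {zero}  f g a = solve 1 (λ a → con 0ℚ := con 0ℚ :- a :* con 0ℚ) refl a
  sum-linear {suc n} f g a = trans (cong (f zero - a * g zero +_) (sum-linear (f ∘ suc) (g ∘ suc) a))
    (solve 5 (λ x y a s t → (x :- a :* y) :+ (s :- a :* t) := (x :+ s) :- a :* (y :+ t)) refl (f zero) (g zero) a _ _)

  *-distribˡ-sum : (a : ℚ) (f : Fin n → ℚ) → a * sumℚ f ≡ sumℚ (λ i → a * f i)
  *-distribˡ-sum {zero}  a f = *-zeroʳ a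
  *-distribˡ-sum {suc n} a f = trans (solve 3 (λ a x s → a :* (x :+ s) := a :* x :+ a :* s) refl a (f zero) _)
    (cong (a * f zero +_) (*-distribˡ-sum a (f ∘ suc)))

  sum-comm : (f : Fin n → Fin k → ℚ) → sumℚ (λ i → sumℚ (f i)) ≡ sumℚ (λ j → sumℚ (λ i → f i j))
  sum-comm {zero} {k} f = sym (sum-zero {k} (λ _ → refl))
  sum-comm {suc n} f = trans (cong (sumℚ (f zero) +_) (sum-comm (f ∘ suc)))
    (sym (sum-+ (f zero) (λ j → sumℚ (λ i → f (suc i) j))))

  sum-punchIn : (v : Fin (suc n)) (f : Fin (suc n) → ℚ) → sumℚ f ≡ f v + sumℚ (f ∘ punchIn v)
  sum-punchIn zero    f = refl
  sum-punchIn {suc n} (suc v) f = trans (cong (f zero +_) (sum-punchIn v (f ∘ suc)))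
    (solve 3 (λ a b c → a :+ (b :+ c) := b :+ (a :+ c)) refl (f zero) (f (suc v)) _)

  ÷-*-cancel : ∀ a z .{{_ : NonZero z}} → (a ÷ z) * z ≡ a
  ÷-*-cancel a z = begin
    a * 1/ z * z   ≡⟨ solve 3 (λ a w z → a :* w :* z := a :* (z :* w)) refl a (1/ z) z ⟩
    a * (z * 1/ z) ≡⟨ cong (a *_) (*-inverseʳ z) ⟩
    a * 1ℚ         ≡⟨ *-identityʳ a ⟩
    a              ∎

  sub-÷-*-cancel : ∀ a z .{{_ : NonZero z}} → a - (a ÷ z) * z ≡ 0ℚ
  sub-÷-*-cancel a z = trans (cong (λ b → a - b) (÷-*-cancel a z)) (+-inverseʳ a)

  x*z≡0⇒x≡0 : ∀ {x z} → z ≢ 0ℚ → x * z ≡ 0ℚ → x ≡ 0ℚ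
  x*z≡0⇒x≡0 {x} {z} z≢0 xz≡0 = begin
    x              ≡⟨ sym (*-identityʳ x) ⟩
    x * 1ℚ         ≡⟨ cong (x *_) (sym (*-inverseʳ z)) ⟩
    x * (z * 1/ z) ≡⟨ sym (*-assoc x z (1/ z)) ⟩
    x * z * 1/ z   ≡⟨ cong (_* 1/ z) xz≡0 ⟩
    0ℚ * 1/ z      ≡⟨ *-zeroˡ (1/ z) ⟩
    0ℚ             ∎
    where instance _ = ≢-nonZero z≢0

  dot : Vector n → Vector n → ℚ
  dot h x = sumℚ (λ i → h i * x i)

  unit : Fin (suc n) → Vector (suc n)
  unit v = insertAt (λ _ → 0ℚ) v 1ℚ

  dot-congʳ : (h : Vector n) {x y : Vector n} → (∀ i → x i ≡ y i) → dot h x ≡ dot h y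
  dot-congʳ h x≗y = sum-cong (λ i → cong (h i *_) (x≗y i))

  dot-comm : (x y : Vector n) → dot x y ≡ dot y x
  dot-comm x y = sum-cong (λ i → *-comm (x i) (y i))

  dot-sub : (h x y : Vector n) (a : ℚ) → dot h (λ i → x i - a * y i) ≡ dot h x - a * dot h y
  dot-sub h x y a = trans
    (sum-cong (λ i → solve 4 (λ h x a y → h :* (x :- a :* y) := h :* x :- a :* (h :* y)) refl (h i) (x i) a (y i)))
    (sum-linear (λ i → h i * x i) (λ i → h i * y i) a)

  dot-subˡ : (x y h : Vector n) (a : ℚ) → dot (λ i → x i - a * y i) h ≡ dot x h - a * dot y h
  dot-subˡ x y h a = trans
    (sum-cong (λ i → solve 4 (λ x a y h → (x :- a :* y) :* h := x :* h :- a :* (y :* h)) refl (x i) a (y i) (h i)))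
    (sum-linear (λ i → x i * h i) (λ i → y i * h i) a)

  dot-zeroʳ : (h : Vector n) {x : Vector n} → (∀ i → x i ≡ 0ℚ) → dot h x ≡ 0ℚ
  dot-zeroʳ h x≗0 = sum-zero (λ i → trans (cong (h i *_) (x≗0 i)) (*-zeroʳ (h i)))

  dot-punchIn : (v : Fin (suc n)) (h x : Vector (suc n)) →
    dot h x ≡ h v * x v + dot (h ∘ punchIn v) (x ∘ punchIn v)
  dot-punchIn v h x = sum-punchIn v (λ i → h i * x i)

  dot-insertAt : (h : Vector (suc n)) (w : Vector n) (v : Fin (suc n)) (a : ℚ) →
    dot h (insertAt w v a) ≡ h v * a + dot (h ∘ punchIn v) w
  dot-insertAt h w v a = trans (dot-punchIn v h (insertAt w v a))
    (cong₂ (λ b c → h v * b + c) (insertAt-lookup w v a) (dot-congʳ (h ∘ punchIn v) (insertAt-punchIn w v a)))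

  dot-unit : (v : Fin (suc n)) (x : Vector (suc n)) → dot (unit v) x ≡ x v
  dot-unit v x = begin
    dot (unit v) x                             ≡⟨ dot-comm (unit v) x ⟩
    dot x (unit v)                             ≡⟨ dot-insertAt x (λ _ → 0ℚ) v 1ℚ ⟩
    x v * 1ℚ + dot (x ∘ punchIn v) (λ _ → 0ℚ)  ≡⟨ cong (x v * 1ℚ +_) (dot-zeroʳ (x ∘ punchIn v) (λ _ → refl)) ⟩
    x v * 1ℚ + 0ℚ                              ≡⟨ solve 1 (λ a → a :* con 1ℚ :+ con 0ℚ := a) refl (x v) ⟩
    x v                                        ∎

  unit-off : {v j : Fin (suc n)} → v ≢ j → unit v j ≡ 0ℚ
  unit-off {v = v} v≢j = trans (cong (unit v) (sym (punchIn-punchOut v≢j))) (insertAt-punchIn (λ _ → 0ℚ) v 1ℚ _)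

  dot-transpose : (M : Fin p → Fin q → ℚ) (y : Vector p) (x : Vector q) →
    dot y (λ i → dot (M i) x) ≡ dot (λ j → dot (λ i → M i j) y) x
  dot-transpose M y x = begin
    sumℚ (λ i → y i * sumℚ (λ j → M i j * x j))
      ≡⟨ sum-cong (λ i → *-distribˡ-sum (y i) (λ j → M i j * x j)) ⟩
    sumℚ (λ i → sumℚ (λ j → y i * (M i j * x j)))
      ≡⟨ sum-comm (λ i j → y i * (M i j * x j)) ⟩
    sumℚ (λ j → sumℚ (λ i → y i * (M i j * x j)))
      ≡⟨ sum-cong (λ j → sum-cong (λ i →
           solve 3 (λ y a x → y :* (a :* x) := x :* (a :* y)) refl (y i) (M i j) (x j))) ⟩
    sumℚ (λ j → sumℚ (λ i → x j * (M i j * y i)))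
      ≡⟨ sum-cong (λ j → sym (*-distribˡ-sum (x j) (λ i → M i j * y i))) ⟩
    dot x (λ j → dot (λ i → M i j) y)
      ≡⟨ dot-comm x _ ⟩
    dot (λ j → dot (λ i → M i j) y) x ∎

  dot-lincomb : (h : Vector n) (c : Fin k → ℚ) (b : Fin k → Vector n) →
    dot h (lincomb c b) ≡ sumℚ (λ t → c t * dot h (b t))
  dot-lincomb h c b = begin
    sumℚ (λ i → h i * sumℚ (λ t → c t * b t i))
      ≡⟨ sum-cong (λ i → *-distribˡ-sum (h i) (λ t → c t * b t i)) ⟩
    sumℚ (λ i → sumℚ (λ t → h i * (c t * b t i)))
      ≡⟨ sum-comm (λ i t → h i * (c t * b t i)) ⟩
    sumℚ (λ t → sumℚ (λ i → h i * (c t * b t i)))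
      ≡⟨ sum-cong (λ t → sum-cong (λ i →
           solve 3 (λ h c b → h :* (c :* b) := c :* (h :* b)) refl (h i) (c t) (b t i))) ⟩
    sumℚ (λ t → sumℚ (λ i → c t * (h i * b t i)))
      ≡⟨ sum-cong (λ t → sym (*-distribˡ-sum (c t) (λ i → h i * b t i))) ⟩
    sumℚ (λ t → c t * dot h (b t)) ∎

  Independent : (Fin k → Vector n) → Set
  Independent b = ∀ c → (∀ i → lincomb c b i ≡ 0ℚ) → ∀ t → c t ≡ 0ℚ

  InSpan : Vector n → (Fin k → Vector n) → Set
  InSpan {k = k} x b = Σ (Fin k → ℚ) λ c → ∀ i → x i ≡ lincomb c b i

  IsBasis : (Vector n → Set) → (Fin k → Vector n) → Set
  IsBasis P b = (∀ t → P (b t)) × Independent b × (∀ x → P x → InSpan x b)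

  HasDim : (Vector n → Set) → ℕ → Set
  HasDim {n} P k = Σ (Fin k → Vector n) (IsBasis P)

  lincomb-sub : (c d : Fin k → ℚ) (a : ℚ) (b : Fin k → Vector n) (i : Fin n) →
    lincomb (λ t → c t - a * d t) b i ≡ lincomb c b i - a * lincomb d b i
  lincomb-sub c d a b i = trans
    (sum-cong (λ t → solve 4 (λ c a d x → (c :- a :* d) :* x := c :* x :- a :* (d :* x)) refl (c t) a (d t) (b t i)))
    (sum-linear (λ t → c t * b t i) (λ t → d t * b t i) a)

  lincomb-tail : (c : Fin (suc k) → ℚ) (b : Fin (suc k) → Vector n) (i : Fin n) → c zero ≡ 0ℚ →
    lincomb c b i ≡ lincomb (c ∘ suc) (b ∘ suc) i
  lincomb-tail c b i c₀≡0 = trans (cong (λ a → a * b zero i + lincomb (c ∘ suc) (b ∘ suc) i) c₀≡0)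
    (solve 2 (λ x s → con 0ℚ :* x :+ s := s) refl (b zero i) (lincomb (c ∘ suc) (b ∘ suc) i))

  1≢0 : 1ℚ ≢ 0ℚ
  1≢0 ()

  independent⇒nonzero : {b : Fin k → Vector n} → Independent b → (t : Fin k) → ¬ (∀ i → b t i ≡ 0ℚ)
  independent⇒nonzero {suc k} {b = b} ind t bₜ≡0 = 1≢0 (trans (sym (insertAt-lookup (λ _ → 0ℚ) t 1ℚ))
    (ind (unit t) (λ i → trans (dot-unit t (λ s → b s i)) (bₜ≡0 i)) t))

  eliminate : (Fin (suc k) → Vector n) → Fin (suc k) → (Fin k → ℚ) → Fin k → Vector n
  eliminate b t₀ α s i = b (punchIn t₀ s) i - α s * b t₀ i

  lincomb-eliminate : (b : Fin (suc k) → Vector n) (t₀ : Fin (suc k)) (α d : Fin k → ℚ) (i : Fin n) →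
    lincomb d (eliminate b t₀ α) i ≡ lincomb d (b ∘ punchIn t₀) i - sumℚ (λ s → d s * α s) * b t₀ i
  lincomb-eliminate b t₀ α d i = begin
    sumℚ (λ s → d s * (b (punchIn t₀ s) i - α s * b t₀ i))
      ≡⟨ sum-cong (λ s → solve 4 (λ d x a y → d :* (x :- a :* y) := d :* x :- y :* (d :* a)) refl
                                 (d s) (b (punchIn t₀ s) i) (α s) (b t₀ i)) ⟩
    sumℚ (λ s → d s * b (punchIn t₀ s) i - b t₀ i * (d s * α s))
      ≡⟨ sum-linear (λ s → d s * b (punchIn t₀ s) i) (λ s → d s * α s) (b t₀ i) ⟩
    lincomb d (b ∘ punchIn t₀) i - b t₀ i * σ
      ≡⟨ cong (λ a → lincomb d (b ∘ punchIn t₀) i - a) (*-comm (b t₀ i) σ) ⟩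
    lincomb d (b ∘ punchIn t₀) i - σ * b t₀ i ∎
    where σ = sumℚ (λ s → d s * α s)

  eliminate-independent : (b : Fin (suc k) → Vector n) (t₀ : Fin (suc k)) (α : Fin k → ℚ) →
    Independent b → Independent (eliminate b t₀ α)
  eliminate-independent b t₀ α ind d d·e≡0 s =
    trans (sym (insertAt-punchIn d t₀ (- σ) s)) (ind c c·b≡0 (punchIn t₀ s))
    where
    σ = sumℚ (λ s → d s * α s)
    c = insertAt d t₀ (- σ)
    c·b≡0 : ∀ i → lincomb c b i ≡ 0ℚ
    c·b≡0 i = begin
      lincomb c b i
        ≡⟨ sum-punchIn t₀ (λ t → c t * b t i) ⟩
      c t₀ * b t₀ i + lincomb (c ∘ punchIn t₀) (b ∘ punchIn t₀) i
        ≡⟨ cong₂ (λ a e → a * b t₀ i + e) (insertAt-lookup d t₀ (- σ))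
                 (sum-cong (λ s → cong (_* b (punchIn t₀ s) i) (insertAt-punchIn d t₀ (- σ) s))) ⟩
      - σ * b t₀ i + lincomb d (b ∘ punchIn t₀) i
        ≡⟨ solve 3 (λ σ x L → (:- σ) :* x :+ L := L :- σ :* x) refl σ (b t₀ i) (lincomb d (b ∘ punchIn t₀) i) ⟩
      lincomb d (b ∘ punchIn t₀) i - σ * b t₀ i
        ≡⟨ sym (lincomb-eliminate b t₀ α d i) ⟩
      lincomb d (eliminate b t₀ α) i
        ≡⟨ d·e≡0 i ⟩
      0ℚ ∎

  -- Either no b t uses b′ zero, or one does and pivoting on it eliminates b′ zero from the others.
  independent-in-span⇒≤ : ∀ l (b : Fin k → Vector n) (b′ : Fin l → Vector n) (C : Fin k → Fin l → ℚ) →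
    Independent b → (∀ t i → b t i ≡ lincomb (C t) b′ i) → k ≤ l
  independent-in-span⇒≤ {zero}  l       b b′ C ind b≡Cb′ = z≤n
  independent-in-span⇒≤ {suc k} zero    b b′ C ind b≡Cb′ =
    ⊥-elim (independent⇒nonzero {b = b} ind zero (b≡Cb′ zero))
  independent-in-span⇒≤ {suc k} (suc l) b b′ C ind b≡Cb′ with all? (λ t → C t zero ≟ 0ℚ)
  ... | yes C₀≡0 = m≤n⇒m≤1+n (independent-in-span⇒≤ l b (b′ ∘ suc) (λ t → C t ∘ suc) ind
                     (λ t i → trans (b≡Cb′ t i) (lincomb-tail (C t) b′ i (C₀≡0 t))))
  ... | no C₀≢0 with ¬∀⟶∃¬ _ _ (λ t → C t zero ≟ 0ℚ) C₀≢0
  ...   | t₀ , pivot≢0 = s≤s (independent-in-span⇒≤ l (eliminate b t₀ α) (b′ ∘ suc) (λ s → D s ∘ suc)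
                                (eliminate-independent b t₀ α ind) e≡Db′)
    where
    instance _ = ≢-nonZero pivot≢0
    α : Fin k → ℚ
    α s = C (punchIn t₀ s) zero ÷ C t₀ zero
    D : Fin k → Fin (suc l) → ℚ
    D s j = C (punchIn t₀ s) j - α s * C t₀ j
    e≡Db′ : ∀ s i → eliminate b t₀ α s i ≡ lincomb (D s ∘ suc) (b′ ∘ suc) i
    e≡Db′ s i = begin
      b (punchIn t₀ s) i - α s * b t₀ i
        ≡⟨ cong₂ (λ x y → x - α s * y) (b≡Cb′ (punchIn t₀ s) i) (b≡Cb′ t₀ i) ⟩
      lincomb (C (punchIn t₀ s)) b′ i - α s * lincomb (C t₀) b′ i
        ≡⟨ sym (lincomb-sub (C (punchIn t₀ s)) (C t₀) (α s) b′ i) ⟩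
      lincomb (D s) b′ i
        ≡⟨ lincomb-tail (D s) b′ i (sub-÷-*-cancel (C (punchIn t₀ s) zero) (C t₀ zero)) ⟩
      lincomb (D s ∘ suc) (b′ ∘ suc) i ∎

  dim-unique : {P : Vector n → Set} → HasDim P k → HasDim P l → k ≡ l
  dim-unique (b , b∈P , b-ind , b-span) (b′ , b′∈P , b′-ind , b′-span) = ≤-antisym
    (independent-in-span⇒≤ _ b b′ (proj₁ ∘ b′-span-b) b-ind (proj₂ ∘ b′-span-b))
    (independent-in-span⇒≤ _ b′ b (proj₁ ∘ b-span-b′) b′-ind (proj₂ ∘ b-span-b′))
    where
    b′-span-b = λ t → b′-span (b t) (b∈P t)
    b-span-b′ = λ t → b-span (b′ t) (b′∈P t)

  _∩ker_ : (Vector n → Set) → Vector n → Vector n → Set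
  (P ∩ker h) x = P x × dot h x ≡ 0ℚ

  Vanishes : Vector n → (Vector n → Set) → Set
  Vanishes h P = ∀ x → P x → dot h x ≡ 0ℚ

  Nonvanishing : Vector n → (Vector n → Set) → Set
  Nonvanishing {n} h P = Σ (Vector n) λ x → P x × dot h x ≢ 0ℚ

  LinearlyClosed : (Vector n → Set) → Set
  LinearlyClosed P = ∀ a {x y} → P x → P y → P (λ i → x i - a * y i)

  inKer-closed : (G : Digraph n) → LinearlyClosed (InKer G)
  inKer-closed G a {x} {y} x∈ker y∈ker i = trans (dot-sub (adj G i) x y a)
    (trans (cong₂ (λ b c → b - a * c) (x∈ker i) (y∈ker i)) (solve 1 (λ a → con 0ℚ :- a :* con 0ℚ := con 0ℚ) refl a))

  line-meets-ker-once : (h L y : Vector n) (γ : ℚ) → dot h y ≢ 0ℚ → dot h L ≡ 0ℚ →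
    dot h (λ i → L i - γ * y i) ≡ 0ℚ → γ ≡ 0ℚ
  line-meets-ker-once h L y γ h·y≢0 h·L≡0 h·[L-γy]≡0 = x*z≡0⇒x≡0 h·y≢0 (begin
    γ * dot h y
      ≡⟨ solve 3 (λ a b c → a :* b := c :- (c :- a :* b)) refl γ (dot h y) (dot h L) ⟩
    dot h L - (dot h L - γ * dot h y)
      ≡⟨ cong₂ (λ a b → a - b) h·L≡0 (trans (sym (dot-sub h L y γ)) h·[L-γy]≡0) ⟩
    0ℚ ∎)

  module _ {P : Vector n → Set} (h : Vector n) where

    vanishes-on-basis : {b : Fin k → Vector n} → IsBasis P b → (∀ t → dot h (b t) ≡ 0ℚ) → Vanishes h P
    vanishes-on-basis {b = b} (_ , _ , span) h·b≡0 x x∈P = begin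
      dot h x                         ≡⟨ dot-congʳ h (proj₂ (span x x∈P)) ⟩
      dot h (lincomb c b)             ≡⟨ dot-lincomb h c b ⟩
      sumℚ (λ t → c t * dot h (b t))  ≡⟨ sum-zero (λ t → trans (cong (c t *_) (h·b≡0 t)) (*-zeroʳ (c t))) ⟩
      0ℚ                              ∎
      where c = proj₁ (span x x∈P)

    pivot-or-vanishes : {b : Fin k → Vector n} → IsBasis P b →
      (Σ (Fin k) λ t → dot h (b t) ≢ 0ℚ) ⊎ Vanishes h P
    pivot-or-vanishes {b = b} basis with all? (λ t → dot h (b t) ≟ 0ℚ)
    ... | yes h·b≡0  = inj₂ (vanishes-on-basis basis h·b≡0)
    ... | no  h·b≢0  = inj₁ (¬∀⟶∃¬ _ _ (λ t → dot h (b t) ≟ 0ℚ) h·b≢0)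

    basis-∩ker-vanishing : {b : Fin k → Vector n} → Vanishes h P → IsBasis P b → IsBasis (P ∩ker h) b
    basis-∩ker-vanishing van (b∈P , ind , span) = (λ t → b∈P t , van _ (b∈P t)) , ind , λ x → span x ∘ proj₁

    hasDim-∩ker-pivot : {b : Fin (suc k) → Vector n} → LinearlyClosed P → IsBasis P b →
      (t₀ : Fin (suc k)) → dot h (b t₀) ≢ 0ℚ → HasDim (P ∩ker h) k
    hasDim-∩ker-pivot {k} {b} closed (b∈P , ind , span) t₀ z≢0 =
      eliminate b t₀ α , e∈P∩ker , eliminate-independent b t₀ α ind , e-span
      where
      instance _ = ≢-nonZero z≢0
      z = dot h (b t₀)
      α : Fin k → ℚ
      α s = dot h (b (punchIn t₀ s)) ÷ z
      e∈P∩ker : ∀ s → (P ∩ker h) (eliminate b t₀ α s)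
      e∈P∩ker s = closed (α s) (b∈P (punchIn t₀ s)) (b∈P t₀) ,
        trans (dot-sub h (b (punchIn t₀ s)) (b t₀) (α s)) (sub-÷-*-cancel (dot h (b (punchIn t₀ s))) z)
      e-span : ∀ x → (P ∩ker h) x → InSpan x (eliminate b t₀ α)
      e-span x (x∈P , h·x≡0) = d , x≡L
        where
        c = proj₁ (span x x∈P)
        d = c ∘ punchIn t₀
        σ = sumℚ (λ s → d s * α s)
        γ = - (c t₀ + σ)
        L = lincomb d (eliminate b t₀ α)
        x≡L-γb : ∀ i → x i ≡ L i - γ * b t₀ i
        x≡L-γb i = begin
          x i
            ≡⟨ proj₂ (span x x∈P) i ⟩
          lincomb c b i
            ≡⟨ sum-punchIn t₀ (λ t → c t * b t i) ⟩
          c t₀ * b t₀ i + lincomb d (b ∘ punchIn t₀) i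
            ≡⟨ solve 4 (λ c y σ L → c :* y :+ L := (L :- σ :* y) :- (:- (c :+ σ)) :* y) refl
                       (c t₀) (b t₀ i) σ (lincomb d (b ∘ punchIn t₀) i) ⟩
          (lincomb d (b ∘ punchIn t₀) i - σ * b t₀ i) - γ * b t₀ i
            ≡⟨ cong (λ e → e - γ * b t₀ i) (sym (lincomb-eliminate b t₀ α d i)) ⟩
          L i - γ * b t₀ i ∎
        h·L≡0 : dot h L ≡ 0ℚ
        h·L≡0 = trans (dot-lincomb h d (eliminate b t₀ α))
          (sum-zero (λ s → trans (cong (d s *_) (proj₂ (e∈P∩ker s))) (*-zeroʳ (d s))))
        γ≡0 : γ ≡ 0ℚ
        γ≡0 = line-meets-ker-once h L (b t₀) γ z≢0 h·L≡0 (trans (sym (dot-congʳ h x≡L-γb)) h·x≡0)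
        x≡L : ∀ i → x i ≡ L i
        x≡L i = trans (x≡L-γb i) (trans (cong (λ g → L i - g * b t₀ i) γ≡0)
          (solve 2 (λ L y → L :- con 0ℚ :* y := L) refl (L i) (b t₀ i)))

    hasDim-∩ker : LinearlyClosed P → HasDim P k → Σ ℕ (HasDim (P ∩ker h))
    hasDim-∩ker closed (b , basis) with pivot-or-vanishes basis
    hasDim-∩ker {k}     closed (b , basis) | inj₂ van           = k , b , basis-∩ker-vanishing van basis
    hasDim-∩ker {suc k} closed (b , basis) | inj₁ (t₀ , h·b≢0) = k , hasDim-∩ker-pivot closed basis t₀ h·b≢0

    dim-∩ker-vanishing : Vanishes h P → HasDim P k → HasDim (P ∩ker h) l → k ≡ l
    dim-∩ker-vanishing van (b , basis) = dim-unique (b , basis-∩ker-vanishing van basis)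

    dim-∩ker-nonvanishing : LinearlyClosed P → Nonvanishing h P → HasDim P k → HasDim (P ∩ker h) l → k ≡ suc l
    dim-∩ker-nonvanishing closed (x , x∈P , h·x≢0) (b , basis) with pivot-or-vanishes basis
    ... | inj₂ van = ⊥-elim (h·x≢0 (van x x∈P))
    dim-∩ker-nonvanishing {suc k} closed _ (b , basis) | inj₁ (t₀ , h·b≢0) =
      cong suc ∘ dim-unique (hasDim-∩ker-pivot closed basis t₀ h·b≢0)

    vanishes-or-nonvanishing : HasDim P k → Vanishes h P ⊎ Nonvanishing h P
    vanishes-or-nonvanishing (b , basis@(b∈P , _)) with pivot-or-vanishes basis
    ... | inj₁ (t₀ , h·b≢0) = inj₂ (b t₀ , b∈P t₀ , h·b≢0)
    ... | inj₂ van          = inj₁ van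

  Solvable : (Fin p → Fin q → ℚ) → Vector p → Set
  Solvable {q = q} M b = Σ (Vector q) λ z → ∀ i → dot (M i) z ≡ b i

  Obstructed : (Fin p → Fin q → ℚ) → Vector p → Set
  Obstructed {p} M b = Σ (Vector p) λ y → (∀ j → dot (λ i → M i j) y ≡ 0ℚ) × dot b y ≢ 0ℚ

  fredholm-alternative : ∀ q (M : Fin p → Fin q → ℚ) (b : Vector p) → Solvable M b ⊎ Obstructed M b
  fredholm-alternative {zero} zero M b = inj₁ ((λ ()) , λ ())
  fredholm-alternative {suc p} zero M b with all? (λ i → b i ≟ 0ℚ)
  ... | yes b≡0 = inj₁ ((λ ()) , λ i → sym (b≡0 i))
  ... | no  b≢0 with ¬∀⟶∃¬ _ _ (λ i → b i ≟ 0ℚ) b≢0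
  ...   | i , bᵢ≢0 =
    inj₂ (unit i , (λ ()) , λ b·eᵢ≡0 → bᵢ≢0 (trans (sym (dot-unit i b)) (trans (dot-comm (unit i) b) b·eᵢ≡0)))
  fredholm-alternative (suc q) M b with fredholm-alternative q (λ i → M i ∘ suc) b
  ... | inj₁ (z , M′z≡b) =
    inj₁ (0ℚ ∷ z , λ i → trans (solve 2 (λ a s → a :* con 0ℚ :+ s := s) refl (M i zero) _) (M′z≡b i))
  ... | inj₂ (y , y⊥M′ , b·y≢0) with dot (λ i → M i zero) y ≟ 0ℚ
  ...   | yes m·y≡0 = inj₂ (y , (λ { zero → m·y≡0 ; (suc j) → y⊥M′ j }) , b·y≢0)
  ...   | no  m·y≢0 = lift (fredholm-alternative q M′ (λ i → b i - t * m i))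
    -- An obstruction y′ to the shifted system becomes one for M once the multiple of y
    -- making it orthogonal to m is subtracted.
    where
    instance _ = ≢-nonZero m·y≢0
    M′ = λ i → M i ∘ suc
    m = λ i → M i zero
    t = dot b y ÷ dot m y
    lift : Solvable M′ (λ i → b i - t * m i) ⊎ Obstructed M′ (λ i → b i - t * m i) → Solvable M b ⊎ Obstructed M b
    lift (inj₁ (z , M′z≡b-tm)) = inj₁ (t ∷ z , λ i → trans (cong (m i * t +_) (M′z≡b-tm i))
      (solve 3 (λ a t b → a :* t :+ (b :- t :* a) := b) refl (m i) t (b i)))
    lift (inj₂ (y′ , y′⊥M′ , [b-tm]·y′≢0)) = inj₂ (y″ , y″⊥M , [b-tm]·y′≢0 ∘ trans [b-tm]·y′≡b·y″)
      where
      β = dot m y′ ÷ dot m y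
      y″ = λ i → y′ i - β * y i
      y″⊥M : ∀ j → dot (λ i → M i j) y″ ≡ 0ℚ
      y″⊥M zero    = trans (dot-sub m y′ y β) (sub-÷-*-cancel (dot m y′) (dot m y))
      y″⊥M (suc j) = trans (dot-sub (λ i → M i (suc j)) y′ y β)
        (trans (cong₂ (λ a c → a - β * c) (y′⊥M′ j) (y⊥M′ j))
               (solve 1 (λ β → con 0ℚ :- β :* con 0ℚ := con 0ℚ) refl β))
      [b-tm]·y′≡b·y″ : dot (λ i → b i - t * m i) y′ ≡ dot b y″
      [b-tm]·y′≡b·y″ = begin
        dot (λ i → b i - t * m i) y′
          ≡⟨ dot-subˡ b m y′ t ⟩
        dot b y′ - t * dot m y′
          ≡⟨ cong (λ e → dot b y′ - e)
                  (solve 3 (λ u w v → u :* w :* v := v :* w :* u) refl (dot b y) (1/ dot m y) (dot m y′)) ⟩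
        dot b y′ - β * dot b y
          ≡⟨ sym (dot-sub b y′ y β) ⟩
        dot b y″ ∎

module VertexDeletion {m} (G : Digraph (suc m)) (v : Fin (suc m)) where

  open import Data.Bool using (true; false; if_then_else_)
  import Data.Bool as Bool
  open import Data.Bool.Properties using (¬-not)
  open import Data.Rational using (0ℚ; 1ℚ; _+_; _*_; _-_; _÷_; ≢-nonZero)
  open import Data.Rational.Properties using (*-zeroˡ)
  open import Data.Rational.Solver using (module +-*-Solver)
  open import Relation.Nullary.Decidable using (does; dec-true; dec-false)
  open +-*-Solver
  open ≡-Reasoning
  open LinearAlgebra

  G′ : Digraph m
  G′ = delete G v

  r : Vector m
  r i = adj G v (punchIn v i)

  extend : Vector m → Vector (suc m)
  extend w = insertAt w v 0ℚ

  dot-adj-extend : ∀ j w → dot (adj G j) (extend w) ≡ dot (λ i → adj G j (punchIn v i)) w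
  dot-adj-extend j w = trans (dot-insertAt (adj G j) w v 0ℚ)
    (solve 2 (λ a s → a :* con 0ℚ :+ s := s) refl (adj G j v) (dot (λ i → adj G j (punchIn v i)) w))

  dot-adj-restrict : ∀ j x → x v ≡ 0ℚ → dot (adj G j) x ≡ dot (λ i → adj G j (punchIn v i)) (x ∘ punchIn v)
  dot-adj-restrict j x xᵥ≡0 = trans (dot-punchIn v (adj G j) x)
    (trans (cong (λ a → adj G j v * a + s) xᵥ≡0) (solve 2 (λ a s → a :* con 0ℚ :+ s := s) refl (adj G j v) s))
    where s = dot (λ i → adj G j (punchIn v i)) (x ∘ punchIn v)

  extend-∈ : ∀ {w} → (InKer G′ ∩ker r) w → (InKer G ∩ker unit v) (extend w)
  extend-∈ {w} (w∈ker , r·w≡0) =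
    punchIn-cases v (trans (dot-adj-extend v w) r·w≡0) (λ i → trans (dot-adj-extend (punchIn v i) w) (w∈ker i)) ,
    trans (dot-unit v (extend w)) (insertAt-lookup w v 0ℚ)

  restrict-∈ : ∀ {x} → (InKer G ∩ker unit v) x → (InKer G′ ∩ker r) (x ∘ punchIn v)
  restrict-∈ {x} (x∈ker , eᵥ·x≡0) =
    (λ i → trans (sym (dot-adj-restrict (punchIn v i) x xᵥ≡0)) (x∈ker (punchIn v i))) ,
    trans (sym (dot-adj-restrict v x xᵥ≡0)) (x∈ker v)
    where xᵥ≡0 = trans (sym (dot-unit v x)) eᵥ·x≡0

  restrict-hasDim : ∀ {d} → HasDim (InKer G ∩ker unit v) d → HasDim (InKer G′ ∩ker r) d
  restrict-hasDim (b , b∈ , ind , span) =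
    (λ t → b t ∘ punchIn v) , (λ t → restrict-∈ {b t} (b∈ t)) , ind′ , span′
    where
    ind′ : Independent (λ t → b t ∘ punchIn v)
    ind′ c c·b′≡0 = ind c (punchIn-cases v c·bᵥ≡0 c·b′≡0)
      where
      c·bᵥ≡0 = dot-zeroʳ c (λ t → trans (sym (dot-unit v (b t))) (proj₂ (b∈ t)))
    span′ : ∀ w → (InKer G′ ∩ker r) w → InSpan w (λ t → b t ∘ punchIn v)
    span′ w w∈ = c , λ i → trans (sym (insertAt-punchIn w v 0ℚ i)) (ext-w≡cb (punchIn v i))
      where
      c = proj₁ (span (extend w) (extend-∈ w∈))
      ext-w≡cb = proj₂ (span (extend w) (extend-∈ w∈))

  laevoCore⇒vanishes : LaevoCore G v → Vanishes r (InKer G′)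
  laevoCore⇒vanishes (y , y∈coker , yᵥ≢0) w w∈ker = x*z≡0⇒x≡0 yᵥ≢0 (begin
    dot r w * y v
      ≡⟨ solve 2 (λ a b → a :* b := b :* a :+ con 0ℚ) refl (dot r w) (y v) ⟩
    y v * dot r w + 0ℚ
      ≡⟨ cong₂ (λ a b → y v * a + b) (sym (dot-adj-extend v w))
               (sym (dot-zeroʳ (y ∘ punchIn v) (λ i → trans (dot-adj-extend (punchIn v i) w) (w∈ker i)))) ⟩
    y v * Ax v + dot (y ∘ punchIn v) (Ax ∘ punchIn v)
      ≡⟨ sym (dot-punchIn v y Ax) ⟩
    dot y Ax
      ≡⟨ dot-transpose (adj G) y (extend w) ⟩
    dot (λ j → dot (λ i → adj G i j) y) (extend w)
      ≡⟨ trans (dot-comm (λ j → dot (λ i → adj G i j) y) (extend w)) (dot-zeroʳ (extend w) y∈coker) ⟩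
    0ℚ ∎)
    where
    Ax = λ j → dot (adj G j) (extend w)

  laevoCoreForbidden⇒solvable : LaevoCoreForbidden G v → Solvable (adj G) (unit v)
  laevoCoreForbidden⇒solvable forbidden with fredholm-alternative (suc m) (adj G) (unit v)
  ... | inj₁ solution                   = solution
  ... | inj₂ (y , y∈coker , eᵥ·y≢0)    = ⊥-elim (eᵥ·y≢0 (trans (dot-unit v y) (forbidden y y∈coker)))

  nonvanishing-of-preimage : (u : Vector (suc m)) → u v ≡ 0ℚ → (∀ j → dot (adj G j) u ≡ unit v j) →
    Nonvanishing r (InKer G′)
  nonvanishing-of-preimage u uᵥ≡0 Au≡eᵥ = u ∘ punchIn v ,
    (λ i → trans (sym (dot-adj-restrict (punchIn v i) u uᵥ≡0))
                 (trans (Au≡eᵥ (punchIn v i)) (insertAt-punchIn _ v 1ℚ i))) ,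
    λ r·w≡0 → 1≢0 (begin
      1ℚ        ≡⟨ sym (insertAt-lookup _ v 1ℚ) ⟩
      unit v v  ≡⟨ sym (Au≡eᵥ v) ⟩
      dot (adj G v) u ≡⟨ dot-adj-restrict v u uᵥ≡0 ⟩
      dot r (u ∘ punchIn v) ≡⟨ r·w≡0 ⟩
      0ℚ ∎)

  dextroCore⇒nonvanishing : DextroCore G v → Solvable (adj G) (unit v) → Nonvanishing r (InKer G′)
  dextroCore⇒nonvanishing (x , x∈ker , xᵥ≢0) (z , Az≡eᵥ) =
    nonvanishing-of-preimage (λ k → z k - α * x k) (sub-÷-*-cancel (z v) (x v)) Au≡eᵥ
    where
    instance _ = ≢-nonZero xᵥ≢0
    α = z v ÷ x v
    Au≡eᵥ : ∀ j → dot (adj G j) (λ k → z k - α * x k) ≡ unit v j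
    Au≡eᵥ j = trans (dot-sub (adj G j) z x α) (trans (cong₂ (λ a b → a - α * b) (Az≡eᵥ j) (x∈ker j))
      (solve 2 (λ e α → e :- α :* con 0ℚ := e) refl (unit v j) α))

  dot-adj-cong : ∀ j {x y : Vector (suc m)} → (∀ k → G j k ≡ true → x k ≡ y k) → dot (adj G j) x ≡ dot (adj G j) y
  dot-adj-cong j x≡y-on-arcs = sum-cong (λ k → if-*-cong (G j k) (x≡y-on-arcs k))
    where
    if-*-cong : ∀ c {a b} → (c ≡ true → a ≡ b) → (if c then 1ℚ else 0ℚ) * a ≡ (if c then 1ℚ else 0ℚ) * b
    if-*-cong true  a≡b = cong (1ℚ *_) (a≡b refl)
    if-*-cong false {a} {b} _ = trans (*-zeroˡ a) (sym (*-zeroˡ b))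

  bipartite⇒nonvanishing : Bipartite G → Solvable (adj G) (unit v) → Nonvanishing r (InKer G′)
  -- A row in the colour class of v only meets the other class, where u = z; a row in the
  -- other class only meets the class of v, where u = 0.
  bipartite⇒nonvanishing (colour , proper) (z , Az≡eᵥ) = nonvanishing-of-preimage u (u-off v refl) Au≡eᵥ
    where
    u : Vector (suc m)
    u k = if does (colour k Bool.≟ colour v) then 0ℚ else z k
    u-off : ∀ k → colour k ≡ colour v → u k ≡ 0ℚ
    u-off k k∼v = cong (λ c → if c then 0ℚ else z k) (dec-true (colour k Bool.≟ colour v) k∼v)
    u-on : ∀ k → colour k ≢ colour v → u k ≡ z k
    u-on k k≁v = cong (λ c → if c then 0ℚ else z k) (dec-false (colour k Bool.≟ colour v) k≁v)
    Au≡eᵥ : ∀ j → dot (adj G j) u ≡ unit v j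
    Au≡eᵥ j with colour j Bool.≟ colour v
    ... | yes j∼v = begin
      dot (adj G j) u  ≡⟨ dot-adj-cong j (λ k j→k → u-on k (λ k∼v → proper j k j→k (trans j∼v (sym k∼v)))) ⟩
      dot (adj G j) z  ≡⟨ Az≡eᵥ j ⟩
      unit v j         ∎
    ... | no  j≁v = begin
      dot (adj G j) u
        ≡⟨ dot-adj-cong j (λ k j→k → u-off k (trans (¬-not (proper j k j→k ∘ sym)) (sym (¬-not (j≁v ∘ sym))))) ⟩
      dot (adj G j) (λ _ → 0ℚ)
        ≡⟨ dot-zeroʳ (adj G j) (λ _ → refl) ⟩
      0ℚ
        ≡⟨ sym (unit-off (j≁v ∘ cong colour ∘ sym)) ⟩
      unit v j ∎

  K₀ : Vector (suc m) → Set
  K₀ = InKer G ∩ker unit v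

  hasDim-K₀ : ∀ {k} → Nullity G k → Σ ℕ (HasDim K₀)
  hasDim-K₀ = hasDim-∩ker (unit v) (inKer-closed G)

  nullity-dextroCore : ∀ {k d} → DextroCore G v → Nullity G k → HasDim K₀ d → k ≡ suc d
  nullity-dextroCore (x , x∈ker , xᵥ≢0) =
    dim-∩ker-nonvanishing (unit v) (inKer-closed G) (x , x∈ker , xᵥ≢0 ∘ trans (sym (dot-unit v x)))

  nullity-dextroCoreForbidden : ∀ {k d} → DextroCoreForbidden G v → Nullity G k → HasDim K₀ d → k ≡ d
  nullity-dextroCoreForbidden forbidden =
    dim-∩ker-vanishing (unit v) (λ x x∈ker → trans (dot-unit v x) (forbidden x x∈ker))

  nullity-delete-vanishing : ∀ {l d} → Vanishes r (InKer G′) → Nullity G′ l → HasDim K₀ d → l ≡ d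
  nullity-delete-vanishing vanishes ker-G′ = dim-∩ker-vanishing r vanishes ker-G′ ∘ restrict-hasDim

  nullity-delete-nonvanishing : ∀ {l d} → Nonvanishing r (InKer G′) → Nullity G′ l → HasDim K₀ d → l ≡ suc d
  nullity-delete-nonvanishing nonvanishing ker-G′ =
    dim-∩ker-nonvanishing r (inKer-closed G′) nonvanishing ker-G′ ∘ restrict-hasDim

open import Data.Nat using (_+_; _∸_)
open import Data.Nat.Properties using (+-comm)
open LinearAlgebra

theorem18 : ∀ (m : ℕ) → 1 ≤ m → (G : Digraph (suc m)) → (v : Fin (suc m)) →
    (k l : ℕ) → Nullity G k → 0 < k → Nullity (delete G v) l →
    ((DextroCore G v × LaevoCore G v → l ≡ k ∸ 1) ×
     (DextroCoreForbidden G v × LaevoCore G v → l ≡ k) ×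
     (DextroCore G v × LaevoCoreForbidden G v → l ≡ k) ×
     (DextroCoreForbidden G v × LaevoCoreForbidden G v →
        (l ≡ k ⊎ l ≡ k + 1) × (Bipartite G → l ≡ k + 1)))
theorem18 m _ G v k l ker-G _ ker-G′ = i , ii , iii , iv
  where
  open VertexDeletion G v
  d : ℕ
  d = proj₁ (hasDim-K₀ ker-G)
  K₀-dim : HasDim K₀ d
  K₀-dim = proj₂ (hasDim-K₀ ker-G)
  k≡1+d : DextroCore G v → k ≡ suc d
  k≡1+d core = nullity-dextroCore core ker-G K₀-dim
  k≡d : DextroCoreForbidden G v → k ≡ d
  k≡d forbidden = nullity-dextroCoreForbidden forbidden ker-G K₀-dim
  l≡d : Vanishes r (InKer G′) → l ≡ d
  l≡d vanishes = nullity-delete-vanishing vanishes ker-G′ K₀-dim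
  l≡k+1 : DextroCoreForbidden G v → Nonvanishing r (InKer G′) → l ≡ k + 1
  l≡k+1 forbidden nonvanishing = trans (nullity-delete-nonvanishing nonvanishing ker-G′ K₀-dim)
    (trans (cong suc (sym (k≡d forbidden))) (+-comm 1 k))

  i : DextroCore G v × LaevoCore G v → l ≡ k ∸ 1
  i (core , laevo) = trans (l≡d (laevoCore⇒vanishes laevo)) (cong (_∸ 1) (sym (k≡1+d core)))
  ii : DextroCoreForbidden G v × LaevoCore G v → l ≡ k
  ii (forbidden , laevo) = trans (l≡d (laevoCore⇒vanishes laevo)) (sym (k≡d forbidden))
  iii : DextroCore G v × LaevoCoreForbidden G v → l ≡ k
  iii (core , laevo-forbidden) = trans (nullity-delete-nonvanishing
    (dextroCore⇒nonvanishing core (laevoCoreForbidden⇒solvable laevo-forbidden)) ker-G′ K₀-dim) (sym (k≡1+d core))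
  iv : DextroCoreForbidden G v × LaevoCoreForbidden G v → (l ≡ k ⊎ l ≡ k + 1) × (Bipartite G → l ≡ k + 1)
  iv (forbidden , laevo-forbidden) =
    map (λ vanishes → trans (l≡d vanishes) (sym (k≡d forbidden))) (l≡k+1 forbidden)
      (vanishes-or-nonvanishing r ker-G′) ,
    λ bipartite → l≡k+1 forbidden (bipartite⇒nonvanishing bipartite (laevoCoreForbidden⇒solvable laevo-forbidden))
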